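{- For every integer $n\ge1$, $\gamma_I^p(P_n)=\lceil (n+1)/2\rceil$ and $\gamma_I^p(C_n)=\lceil n/2\rceil$, where $P_n$ and $C_n$ denote the path and the cycle on $n$ vertices.
   Context: For a graph $G=(V,E)$ and $v\in V$, $N(v)$ denotes the set of neighbours of $v$. A perfect Italian dominating function (PID-function) of $G$ is a function $f:V\to\{0,1,2\}$ such that for every vertex $v$ with $f(v)=0$ one has $\sum_{u\in N(v)} f(u)=2$. The weight of $f$ is $\sum_{v\in V} f(v)$; $\gamma_I^p(G)$ is the minimum weight of a PID-function of $G$. -}

module Defs where

open import Data.Nat using (ℕ; zero; suc; _+_; _≤_; _≡ᵇ_; _%_)
open import Data.Nat.Base using (⌈_/2⌉)
open import Data.Fin using (Fin; toℕ)
open import Data.List using (List; map; allFin)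
open import Data.Nat.ListAction using (sum)
open import Data.Bool using (Bool; true; false; if_then_else_; _∧_; _∨_; not)
open import Data.Product using (Σ; _×_; ∃)
open import Relation.Binary.PropositionalEquality using (_≡_)

Graph : ℕ → Set
Graph n = Fin n → Fin n → Bool

nbrSum : ∀ {n} → Graph n → (Fin n → ℕ) → Fin n → ℕ
nbrSum {n} G f v = sum (map (λ u → if G v u then f u else 0) (allFin n))

weight : ∀ {n} → (Fin n → ℕ) → ℕ
weight {n} f = sum (map f (allFin n))

IsPIDF : ∀ {n} → Graph n → (Fin n → ℕ) → Set
IsPIDF G f = (∀ v → f v ≤ 2) × (∀ v → f v ≡ 0 → nbrSum G f v ≡ 2)

PIDNumberIs : ∀ {n} → Graph n → ℕ → Set
PIDNumberIs {n} G k =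
  (Σ (Fin n → ℕ) λ f → IsPIDF G f × weight f ≡ k) ×
  (∀ (f : Fin n → ℕ) → IsPIDF G f → k ≤ weight f)

path : (n : ℕ) → Graph n
path n i j = (suc (toℕ i) ≡ᵇ toℕ j) ∨ (suc (toℕ j) ≡ᵇ toℕ i)

cycle : (n : ℕ) → Graph n
cycle zero     ()
cycle (suc m) i j =
  not (toℕ i ≡ᵇ toℕ j) ∧
  ((suc (toℕ i) % suc m ≡ᵇ toℕ j) ∨ (suc (toℕ j) % suc m ≡ᵇ toℕ i))

{-# OPTIONS --safe #-}
-- Give every vertex i the load N(i) + 2 f(i), where N(i) is the sum of f over the neighbours
-- of i. A PID-function makes every load at least 2 (either f(i) ≥ 1, or f(i) = 0 and N(i) = 2),
-- so the loads sum to at least 2n. On C_n the neighbour sums add up to twice the weight w, so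
-- 4w ≥ 2n. On P_n the endpoints have a single neighbour, so the neighbour sums add up to
-- 2w − f(0) − f(n−1); one unit of slack comes from vertex 0 (either f(0) ≥ 1, or f(1) = 2 and
-- vertex 1 has load at least 4), whence 4w > 2n. Both bounds are attained by 1,0,1,0,…, on P_n
-- with the last vertex also set to 1.
module Submission where

open import Defs
open import Data.Bool using (Bool; true; false; if_then_else_; not; T)
open import Data.Bool.Properties using (T-∧; T-∨)
open import Data.Empty using (⊥; ⊥-elim)
open import Data.Fin as Fin using (Fin; toℕ; fromℕ<)
open import Data.Fin.Properties using (toℕ<n; fromℕ<-toℕ; toℕ-fromℕ<)
open import Data.List using (map; allFin; tabulate)
open import Data.List.Properties using (map-tabulate)
open import Data.Nat
  using (ℕ; zero; suc; _+_; _*_; _≤_; _<_; z≤n; s≤s; s≤s⁻¹; z<s; _≡ᵇ_; _%_; ⌈_/2⌉)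
open import Data.Nat.Properties
open import Data.Nat.DivMod using (m≤n⇒m%n≡m; n%n≡0)
open import Data.Nat.ListAction using (sum)
open import Algebra.Properties.CommutativeSemigroup +-commutativeSemigroup using (interchange; xy∙z≈xz∙y)
open import Data.Product using (_×_; _,_; proj₂)
open import Data.Sum using (_⊎_; inj₁; inj₂)
import Data.Sum as Sum
open import Function using (_∘_; id; _⇔_; mk⇔; Equivalence)
open import Relation.Nullary using (yes; no; contradiction)
open import Relation.Binary.PropositionalEquality

sumTo : ℕ → (ℕ → ℕ) → ℕ
sumTo zero    h = 0
sumTo (suc n) h = h 0 + sumTo n (h ∘ suc)

sumTo-cong : ∀ n {g h : ℕ → ℕ} → (∀ i → i < n → g i ≡ h i) → sumTo n g ≡ sumTo n h
sumTo-cong zero    _   = refl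
sumTo-cong (suc n) g≡h = cong₂ _+_ (g≡h 0 z<s) (sumTo-cong n (λ i i<n → g≡h (suc i) (s≤s i<n)))

sumTo-zero : ∀ n → sumTo n (λ _ → 0) ≡ 0
sumTo-zero zero    = refl
sumTo-zero (suc n) = sumTo-zero n

sumTo-+ : ∀ n (g h : ℕ → ℕ) → sumTo n (λ i → g i + h i) ≡ sumTo n g + sumTo n h
sumTo-+ zero    g h = refl
sumTo-+ (suc n) g h = begin
  (g 0 + h 0) + sumTo n (λ i → g (suc i) + h (suc i)) ≡⟨ cong (g 0 + h 0 +_) (sumTo-+ n (g ∘ suc) (h ∘ suc)) ⟩
  (g 0 + h 0) + (G + H)                                ≡⟨ interchange (g 0) (h 0) G H ⟩
  (g 0 + G) + (h 0 + H)                                ∎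
  where
  open ≡-Reasoning
  G = sumTo n (g ∘ suc)
  H = sumTo n (h ∘ suc)

sumTo-* : ∀ n c (h : ℕ → ℕ) → sumTo n (λ i → c * h i) ≡ c * sumTo n h
sumTo-* zero    c h = sym (*-zeroʳ c)
sumTo-* (suc n) c h =
  trans (cong (c * h 0 +_) (sumTo-* n c (h ∘ suc))) (sym (*-distribˡ-+ c (h 0) _))

sumTo-snoc : ∀ n (h : ℕ → ℕ) → sumTo (suc n) h ≡ sumTo n h + h n
sumTo-snoc zero    h = +-comm (h 0) 0
sumTo-snoc (suc n) h =
  trans (cong (h 0 +_) (sumTo-snoc n (h ∘ suc))) (sym (+-assoc (h 0) _ _))

sumTo-lowerBound : ∀ n {c} {h : ℕ → ℕ} → (∀ i → i < n → c ≤ h i) → n * c ≤ sumTo n h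
sumTo-lowerBound zero    _   = z≤n
sumTo-lowerBound (suc n) c≤h =
  +-mono-≤ (c≤h 0 z<s) (sumTo-lowerBound n (λ i i<n → c≤h (suc i) (s≤s i<n)))

sumTo-indicator : ∀ n c (h : ℕ → ℕ) → (∀ k → n ≤ k → h k ≡ 0) →
                  sumTo n (λ k → if c ≡ᵇ k then h k else 0) ≡ h c
sumTo-indicator zero    c       h h≥n≡0 = sym (h≥n≡0 c z≤n)
sumTo-indicator (suc n) zero    h _     = trans (cong (h 0 +_) (sumTo-zero n)) (+-identityʳ (h 0))
sumTo-indicator (suc n) (suc c) h h≥n≡0 =
  sumTo-indicator n c (h ∘ suc) (λ k n≤k → h≥n≡0 (suc k) (s≤s n≤k))

extend : ∀ {n} → (Fin n → ℕ) → ℕ → ℕ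
extend {n} f k with k <? n
... | yes k<n = f (fromℕ< k<n)
... | no  _   = 0

extend-toℕ : ∀ {n} (f : Fin n → ℕ) u → extend f (toℕ u) ≡ f u
extend-toℕ {n} f u with toℕ u <? n
... | yes u<n = cong f (fromℕ<-toℕ u u<n)
... | no  u≮n = contradiction (toℕ<n u) u≮n

extend-≥ : ∀ {n} (f : Fin n → ℕ) k → n ≤ k → extend f k ≡ 0
extend-≥ {n} f k n≤k with k <? n
... | yes k<n = contradiction n≤k (<⇒≱ k<n)
... | no  _   = refl

∀-toℕ⇒∀-< : ∀ {n} (P : ℕ → Set) → (∀ (v : Fin n) → P (toℕ v)) → ∀ i → i < n → P i
∀-toℕ⇒∀-< P P-toℕ i i<n = subst P (toℕ-fromℕ< i<n) (P-toℕ (fromℕ< i<n))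

extend-restrict : ∀ {n} (g : ℕ → ℕ) k → k < n → extend {n} (g ∘ toℕ) k ≡ g k
extend-restrict {n} g = ∀-toℕ⇒∀-< {n} (λ k → extend {n} (g ∘ toℕ) k ≡ g k) (extend-toℕ (g ∘ toℕ))

sum-tabulate : ∀ n (F : Fin n → ℕ) (H : ℕ → ℕ) → (∀ u → F u ≡ H (toℕ u)) → sum (tabulate F) ≡ sumTo n H
sum-tabulate zero    F H _   = refl
sum-tabulate (suc n) F H F≡H = cong₂ _+_ (F≡H Fin.zero) (sum-tabulate n (F ∘ Fin.suc) (H ∘ suc) (F≡H ∘ Fin.suc))

sum-allFin : ∀ n (F : Fin n → ℕ) (H : ℕ → ℕ) → (∀ u → F u ≡ H (toℕ u)) → sum (map F (allFin n)) ≡ sumTo n H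
sum-allFin n F H F≡H = trans (cong sum (map-tabulate id F)) (sum-tabulate n F H F≡H)

weight-extend : ∀ {n} (f : Fin n → ℕ) → weight f ≡ sumTo n (extend f)
weight-extend {n} f = sum-allFin n f (extend f) (sym ∘ extend-toℕ f)

weight-restrict : ∀ n (g : ℕ → ℕ) → weight {n} (g ∘ toℕ) ≡ sumTo n g
weight-restrict n g = sum-allFin n (g ∘ toℕ) g (λ _ → refl)

if-⊎ : ∀ a b c {x : ℕ} → (T a ⇔ (T b ⊎ T c)) → (T b → T c → ⊥) →
       (if a then x else 0) ≡ (if b then x else 0) + (if c then x else 0)
if-⊎ true  true  true  _  b∧c = ⊥-elim (b∧c _ _)
if-⊎ true  true  false _  _   = sym (+-identityʳ _)
if-⊎ true  false true  _  _   = refl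
if-⊎ true  false false a⇔ _   = ⊥-elim (Sum.reduce (Equivalence.to a⇔ _))
if-⊎ false true  _     a⇔ _   = ⊥-elim (Equivalence.from a⇔ (inj₁ _))
if-⊎ false false true  a⇔ _   = ⊥-elim (Equivalence.from a⇔ (inj₂ _))
if-⊎ false false false _  _   = refl

≡ᵇ-comm : ∀ m n → (m ≡ᵇ n) ≡ (n ≡ᵇ m)
≡ᵇ-comm zero    zero    = refl
≡ᵇ-comm zero    (suc n) = refl
≡ᵇ-comm (suc m) zero    = refl
≡ᵇ-comm (suc m) (suc n) = ≡ᵇ-comm m n

T-not-≡ᵇ : ∀ {m n} → m ≢ n → T (not (m ≡ᵇ n))
T-not-≡ᵇ {m} {n} m≢n with m ≡ᵇ n in eq
... | true  = m≢n (≡ᵇ⇒≡ m n (subst T (sym eq) _))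
... | false = _

nbrSum-split : ∀ {n} (G : Graph n) (f : Fin n → ℕ) v (b c : ℕ → Bool) →
               (∀ u → T (G v u) ⇔ (T (b (toℕ u)) ⊎ T (c (toℕ u)))) → (∀ k → T (b k) → T (c k) → ⊥) →
               nbrSum G f v ≡ sumTo n (λ k → if b k then extend f k else 0)
                            + sumTo n (λ k → if c k then extend f k else 0)
nbrSum-split {n} G f v b c adjacent disjoint =
  trans (sum-allFin n _ _ split) (sumTo-+ n (λ k → if b k then extend f k else 0) (λ k → if c k then extend f k else 0))
  where
  split : ∀ u → (if G v u then f u else 0)
              ≡ (if b (toℕ u) then extend f (toℕ u) else 0) + (if c (toℕ u) then extend f (toℕ u) else 0)
  split u = trans (cong (λ x → if G v u then x else 0) (sym (extend-toℕ f u)))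
                  (if-⊎ (G v u) (b (toℕ u)) (c (toℕ u)) (adjacent u) (disjoint (toℕ u)))

Perfect : ℕ → (ℕ → ℕ) → (ℕ → ℕ) → Set
Perfect n N h = ∀ i → i < n → h i ≡ 0 → N i ≡ 2

IsPIDF⇒Perfect : ∀ {n} {G : Graph n} {f : Fin n → ℕ} {N : ℕ → ℕ} →
                 (∀ v → nbrSum G f v ≡ N (toℕ v)) → IsPIDF G f → Perfect n N (extend f)
IsPIDF⇒Perfect {f = f} {N} nbrSum≡N (_ , perfect) =
  ∀-toℕ⇒∀-< (λ i → extend f i ≡ 0 → N i ≡ 2)
            (λ v fv≡0 → trans (sym (nbrSum≡N v)) (perfect v (trans (sym (extend-toℕ f v)) fv≡0)))

Perfect⇒IsPIDF : ∀ {n} {G : Graph n} {f : Fin n → ℕ} {N : ℕ → ℕ} →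
                 (∀ v → nbrSum G f v ≡ N (toℕ v)) → (∀ v → f v ≤ 2) → Perfect n N (extend f) → IsPIDF G f
Perfect⇒IsPIDF {f = f} nbrSum≡N f≤2 perfect =
  f≤2 , λ v fv≡0 → trans (nbrSum≡N v) (perfect (toℕ v) (toℕ<n v) (trans (extend-toℕ f v) fv≡0))

PIDNumberIs-intro : ∀ {n} {G : Graph n} {k} (f : Fin n → ℕ) → IsPIDF G f → weight f ≡ k →
                    (∀ g → IsPIDF G g → k ≤ sumTo n (extend g)) → PIDNumberIs G k
PIDNumberIs-intro {k = k} f f-PIDF weight≡k lowerBound =
  (f , f-PIDF , weight≡k) , λ g g-PIDF → subst (k ≤_) (sym (weight-extend g)) (lowerBound g g-PIDF)

load : (ℕ → ℕ) → (ℕ → ℕ) → ℕ → ℕ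
load N h i = N i + 2 * h i

Perfect⇒2≤load : ∀ {n} {N h : ℕ → ℕ} → Perfect n N h → ∀ i → i < n → 2 ≤ load N h i
Perfect⇒2≤load {N = N} {h} perfect i i<n with h i in hi
... | zero  = ≤-reflexive (sym (trans (+-identityʳ (N i)) (perfect i i<n hi)))
... | suc a = ≤-trans (*-monoʳ-≤ 2 (s≤s (z≤n {a}))) (m≤n+m (2 * suc a) (N i))

sumTo-load : ∀ n (N h : ℕ → ℕ) → sumTo n (load N h) ≡ sumTo n N + 2 * sumTo n h
sumTo-load n N h = trans (sumTo-+ n N (λ i → 2 * h i)) (cong (sumTo n N +_) (sumTo-* n 2 h))

Perfect⇒2n≤sumTo-load : ∀ n {N h : ℕ → ℕ} → Perfect n N h → 2 * n ≤ sumTo n (load N h)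
Perfect⇒2n≤sumTo-load n {N} {h} perfect =
  subst (_≤ sumTo n (load N h)) (*-comm n 2) (sumTo-lowerBound n (Perfect⇒2≤load perfect))

m+m≡2*m : ∀ m → m + m ≡ 2 * m
m+m≡2*m m = cong (m +_) (sym (+-identityʳ m))

n≤2m⇒⌈n/2⌉≤m : ∀ {n m} → n ≤ 2 * m → ⌈ n /2⌉ ≤ m
n≤2m⇒⌈n/2⌉≤m {n} {m} n≤2m = begin
  ⌈ n /2⌉         ≤⟨ ⌈n/2⌉-mono n≤2m ⟩
  ⌈ 2 * m /2⌉     ≡⟨ cong ⌈_/2⌉ (m+m≡2*m m) ⟨
  ⌈ m + m /2⌉     ≡⟨ n≡⌈n+n/2⌉ m ⟨
  m               ∎
  where open ≤-Reasoning

-- The path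

left : (ℕ → ℕ) → ℕ → ℕ
left h zero    = 0
left h (suc k) = h k

pathNbrSum : (ℕ → ℕ) → ℕ → ℕ
pathNbrSum h i = h (suc i) + left h i

sumTo-left : ∀ n t (h : ℕ → ℕ) → (∀ k → n ≤ k → h k ≡ 0) →
             sumTo n (λ k → if suc k ≡ᵇ t then h k else 0) ≡ left h t
sumTo-left n zero    h _     = sumTo-zero n
sumTo-left n (suc t) h h≥n≡0 =
  trans (sumTo-cong n (λ k _ → cong (λ b → if b then h k else 0) (≡ᵇ-comm k t)))
        (sumTo-indicator n t h h≥n≡0)

nbrSum-path : ∀ {n} (f : Fin n → ℕ) v → nbrSum (path n) f v ≡ pathNbrSum (extend f) (toℕ v)
nbrSum-path {n} f v =
  trans (nbrSum-split (path n) f v (suc t ≡ᵇ_) (λ k → suc k ≡ᵇ t) (λ _ → T-∨) disjoint)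
        (cong₂ _+_ (sumTo-indicator n (suc t) (extend f) (extend-≥ f))
                   (sumTo-left n t (extend f) (extend-≥ f)))
  where
  t = toℕ v
  disjoint : ∀ k → T (suc t ≡ᵇ k) → T (suc k ≡ᵇ t) → ⊥
  disjoint k t<k k<t = <-asym (≤-reflexive (≡ᵇ⇒≡ (suc t) k t<k)) (≤-reflexive (≡ᵇ⇒≡ (suc k) t k<t))

sumTo-pathNbrSum : ∀ m (h : ℕ → ℕ) → h (suc m) ≡ 0 → sumTo (suc m) (pathNbrSum h) + (h 0 + h m) ≡ 2 * sumTo (suc m) h
sumTo-pathNbrSum m h h[1+m]≡0 = begin
  sumTo n (pathNbrSum h) + (h 0 + h m) ≡⟨ cong (_+ (h 0 + h m)) (sumTo-+ n (h ∘ suc) (left h)) ⟩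
  (A + B) + (h 0 + h m)                ≡⟨ interchange A B (h 0) (h m) ⟩
  (A + h 0) + (B + h m)                ≡⟨ cong₂ _+_ (trans (+-comm A (h 0)) h0+A≡W) (sym (sumTo-snoc m h)) ⟩
  W + W                                ≡⟨ m+m≡2*m W ⟩
  2 * W                                ∎
  where
  open ≡-Reasoning
  n = suc m
  W = sumTo n h
  A = sumTo n (h ∘ suc)
  B = sumTo n (left h)
  h0+A≡W : h 0 + A ≡ W
  h0+A≡W = trans (sumTo-snoc n h) (trans (cong (W +_) h[1+m]≡0) (+-identityʳ W))

pathLoad-lowerBound : ∀ m (h : ℕ → ℕ) → h (suc m) ≡ 0 → Perfect (suc m) (pathNbrSum h) h →
                      2 * suc m < sumTo (suc m) (load (pathNbrSum h) h) + h 0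
pathLoad-lowerBound m h _ perfect with h 0 ≟ 0
... | no h0≢0 = begin-strict
  2 * suc m                              ≤⟨ Perfect⇒2n≤sumTo-load (suc m) perfect ⟩
  sumTo (suc m) (load (pathNbrSum h) h)  <⟨ m<m+n _ (n≢0⇒n>0 h0≢0) ⟩
  sumTo (suc m) (load (pathNbrSum h) h) + h 0 ∎
  where open ≤-Reasoning
pathLoad-lowerBound zero h h1≡0 perfect | yes h0≡0 =
  contradiction (trans (sym h1≡0) (trans (sym (+-identityʳ (h 1))) (perfect 0 z<s h0≡0))) 0≢1+n
pathLoad-lowerBound (suc k) h _ perfect | yes h0≡0 = begin-strict
  2 * (2 + k)                            ≡⟨ *-distribˡ-+ 2 2 k ⟩
  2 * 2 + 2 * k                          <⟨ m<n+m (2 * 2 + 2 * k) {2} z<s ⟩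
  2 + (2 * 2 + 2 * k)                    ≤⟨ +-mono-≤ (2≤load 0 z<s) (+-mono-≤ 4≤load₁ rest) ⟩
  L 0 + (L 1 + sumTo k (L ∘ suc ∘ suc))  ≤⟨ m≤m+n _ (h 0) ⟩
  L 0 + (L 1 + sumTo k (L ∘ suc ∘ suc)) + h 0 ∎
  where
  open ≤-Reasoning
  L = load (pathNbrSum h) h
  2≤load = Perfect⇒2≤load perfect
  h1≡2 : h 1 ≡ 2
  h1≡2 = trans (sym (+-identityʳ (h 1))) (perfect 0 z<s h0≡0)
  4≤load₁ : 2 * 2 ≤ L 1
  4≤load₁ = ≤-trans (≤-reflexive (cong (2 *_) (sym h1≡2))) (m≤n+m (2 * h 1) (pathNbrSum h 1))
  rest : 2 * k ≤ sumTo k (L ∘ suc ∘ suc)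
  rest = Perfect⇒2n≤sumTo-load k (λ i i<k → perfect (2 + i) (s≤s (s≤s i<k)))

path-lowerBound : ∀ m (h : ℕ → ℕ) → h (suc m) ≡ 0 → Perfect (suc m) (pathNbrSum h) h →
                  ⌈ suc (suc m) /2⌉ ≤ sumTo (suc m) h
path-lowerBound m h h[1+m]≡0 perfect = n≤2m⇒⌈n/2⌉≤m (*-cancelˡ-< 2 _ _ (begin-strict
  2 * n                                 <⟨ pathLoad-lowerBound m h h[1+m]≡0 perfect ⟩
  sumTo n (load N h) + h 0              ≤⟨ +-monoʳ-≤ _ (m≤m+n (h 0) (h m)) ⟩
  sumTo n (load N h) + (h 0 + h m)      ≡⟨ cong (_+ (h 0 + h m)) (sumTo-load n N h) ⟩
  (S + 2 * W) + (h 0 + h m)             ≡⟨ xy∙z≈xz∙y S (2 * W) (h 0 + h m) ⟩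
  (S + (h 0 + h m)) + 2 * W             ≡⟨ cong (_+ 2 * W) (sumTo-pathNbrSum m h h[1+m]≡0) ⟩
  2 * W + 2 * W                         ≡⟨ m+m≡2*m (2 * W) ⟩
  2 * (2 * W)                           ∎))
  where
  open ≤-Reasoning
  n = suc m
  N = pathNbrSum h
  S = sumTo n N
  W = sumTo n h

-- The cycle C_(m+1), on the vertices 0, …, m

cyclicSuc : ℕ → ℕ → ℕ
cyclicSuc m t = suc t % suc m

cyclicPred : ℕ → ℕ → ℕ
cyclicPred m zero    = m
cyclicPred m (suc t) = t

cyclicSuc-< : ∀ {m t} → t < m → cyclicSuc m t ≡ suc t
cyclicSuc-< = m≤n⇒m%n≡m

cyclicSuc-last : ∀ m → cyclicSuc m m ≡ 0
cyclicSuc-last m = n%n≡0 (suc m)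

cyclicSuc-cyclicPred : ∀ {m t} → t ≤ m → cyclicSuc m (cyclicPred m t) ≡ t
cyclicSuc-cyclicPred {m} {zero}  _   = cyclicSuc-last m
cyclicSuc-cyclicPred {m} {suc t} t<m = cyclicSuc-< t<m

cyclicPred-cyclicSuc : ∀ {m t} → t ≤ m → cyclicPred m (cyclicSuc m t) ≡ t
cyclicPred-cyclicSuc {m} t≤m with m≤n⇒m<n∨m≡n t≤m
... | inj₁ t<m  = cong (cyclicPred m) (cyclicSuc-< t<m)
... | inj₂ refl = cong (cyclicPred m) (cyclicSuc-last m)

cyclicSuc≢id : ∀ {m t} → 1 ≤ m → t ≤ m → cyclicSuc m t ≢ t
cyclicSuc≢id {m} 1≤m t≤m with m≤n⇒m<n∨m≡n t≤m
... | inj₁ t<m  = λ eq → 1+n≢n (trans (sym (cyclicSuc-< t<m)) eq)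
... | inj₂ refl = λ eq → <⇒≢ 1≤m (trans (sym (cyclicSuc-last m)) eq)

cyclicPred≢id : ∀ {m t} → 1 ≤ m → t ≤ m → cyclicPred m t ≢ t
cyclicPred≢id {m} {t} 1≤m t≤m eq =
  cyclicSuc≢id 1≤m t≤m (trans (cong (cyclicSuc m) (sym eq)) (cyclicSuc-cyclicPred t≤m))

cyclicSuc≢cyclicPred : ∀ {m t} → 2 ≤ m → t ≤ m → cyclicSuc m t ≢ cyclicPred m t
cyclicSuc≢cyclicPred {m} {zero}  2≤m _   eq = <⇒≢ 2≤m (trans (sym (cyclicSuc-< (<⇒≤ 2≤m))) eq)
cyclicSuc≢cyclicPred {m} {suc t} 2≤m t<m eq with m≤n⇒m<n∨m≡n t<m
... | inj₁ 1+t<m = <⇒≢ (m<n⇒m<1+n (n<1+n t)) (sym (trans (sym (cyclicSuc-< 1+t<m)) eq))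
... | inj₂ refl  = <⇒≢ (s≤s⁻¹ 2≤m) (trans (sym (cyclicSuc-last (suc t))) eq)

cycle-adjacent : ∀ {m} → 2 ≤ m → (v u : Fin (suc m)) →
                 T (cycle (suc m) v u) ⇔ (T (cyclicSuc m (toℕ v) ≡ᵇ toℕ u) ⊎ T (cyclicPred m (toℕ v) ≡ᵇ toℕ u))
cycle-adjacent {m} 2≤m v u = mk⇔ to from
  where
  t = toℕ v
  k = toℕ u
  t≤m = s≤s⁻¹ (toℕ<n v)
  k≤m = s≤s⁻¹ (toℕ<n u)
  1≤m = <⇒≤ 2≤m
  pred≡ : cyclicSuc m k ≡ t → cyclicPred m t ≡ k
  pred≡ eq = trans (cong (cyclicPred m) (sym eq)) (cyclicPred-cyclicSuc k≤m)
  suc≡ : cyclicPred m t ≡ k → cyclicSuc m k ≡ t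
  suc≡ eq = trans (cong (cyclicSuc m) (sym eq)) (cyclicSuc-cyclicPred t≤m)
  to : T (cycle (suc m) v u) → T (cyclicSuc m t ≡ᵇ k) ⊎ T (cyclicPred m t ≡ᵇ k)
  to adj = Sum.map₂ (λ e → ≡⇒≡ᵇ _ _ (pred≡ (≡ᵇ⇒≡ _ _ e)))
                    (Equivalence.to T-∨ (proj₂ (Equivalence.to T-∧ adj)))
  from : T (cyclicSuc m t ≡ᵇ k) ⊎ T (cyclicPred m t ≡ᵇ k) → T (cycle (suc m) v u)
  from (inj₁ e) = Equivalence.from T-∧
    ( T-not-≡ᵇ (λ t≡k → cyclicSuc≢id 1≤m t≤m (trans (≡ᵇ⇒≡ _ _ e) (sym t≡k)))
    , Equivalence.from T-∨ (inj₁ e))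
  from (inj₂ e) = Equivalence.from T-∧
    ( T-not-≡ᵇ (λ t≡k → cyclicPred≢id 1≤m t≤m (trans (≡ᵇ⇒≡ _ _ e) (sym t≡k)))
    , Equivalence.from T-∨ (inj₂ (≡⇒≡ᵇ _ _ (suc≡ (≡ᵇ⇒≡ _ _ e)))))

cycleNbrSum : ℕ → (ℕ → ℕ) → ℕ → ℕ
cycleNbrSum m h i = h (cyclicSuc m i) + h (cyclicPred m i)

nbrSum-cycle : ∀ {m} → 2 ≤ m → (f : Fin (suc m) → ℕ) → ∀ v →
               nbrSum (cycle (suc m)) f v ≡ cycleNbrSum m (extend f) (toℕ v)
nbrSum-cycle {m} 2≤m f v =
  trans (nbrSum-split (cycle (suc m)) f v (cyclicSuc m t ≡ᵇ_) (cyclicPred m t ≡ᵇ_) (cycle-adjacent 2≤m v) disjoint)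
        (cong₂ _+_ (sumTo-indicator (suc m) (cyclicSuc m t) (extend f) (extend-≥ f))
                   (sumTo-indicator (suc m) (cyclicPred m t) (extend f) (extend-≥ f)))
  where
  t = toℕ v
  disjoint : ∀ k → T (cyclicSuc m t ≡ᵇ k) → T (cyclicPred m t ≡ᵇ k) → ⊥
  disjoint k e e′ = cyclicSuc≢cyclicPred 2≤m (s≤s⁻¹ (toℕ<n v)) (trans (≡ᵇ⇒≡ _ _ e) (sym (≡ᵇ⇒≡ _ _ e′)))

sumTo-cyclicSuc : ∀ m (h : ℕ → ℕ) → sumTo (suc m) (h ∘ cyclicSuc m) ≡ sumTo (suc m) h
sumTo-cyclicSuc m h = begin
  sumTo (suc m) (h ∘ cyclicSuc m)         ≡⟨ sumTo-snoc m (h ∘ cyclicSuc m) ⟩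
  sumTo m (h ∘ cyclicSuc m) + h (cyclicSuc m m)
    ≡⟨ cong₂ _+_ (sumTo-cong m (λ i i<m → cong h (cyclicSuc-< i<m))) (cong h (cyclicSuc-last m)) ⟩
  sumTo m (h ∘ suc) + h 0                 ≡⟨ +-comm _ (h 0) ⟩
  sumTo (suc m) h                         ∎
  where open ≡-Reasoning

sumTo-cyclicPred : ∀ m (h : ℕ → ℕ) → sumTo (suc m) (h ∘ cyclicPred m) ≡ sumTo (suc m) h
sumTo-cyclicPred m h = trans (+-comm (h m) (sumTo m h)) (sym (sumTo-snoc m h))

cycle-lowerBound : ∀ m (h : ℕ → ℕ) → Perfect (suc m) (cycleNbrSum m h) h → ⌈ suc m /2⌉ ≤ sumTo (suc m) h
cycle-lowerBound m h perfect = n≤2m⇒⌈n/2⌉≤m (*-cancelˡ-≤ 2 (begin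
  2 * n                                   ≤⟨ Perfect⇒2n≤sumTo-load n perfect ⟩
  sumTo n (load N h)                      ≡⟨ sumTo-load n N h ⟩
  sumTo n N + 2 * W                       ≡⟨ cong (_+ 2 * W) (sumTo-+ n (h ∘ cyclicSuc m) (h ∘ cyclicPred m)) ⟩
  (sumTo n (h ∘ cyclicSuc m) + sumTo n (h ∘ cyclicPred m)) + 2 * W
    ≡⟨ cong (_+ 2 * W) (cong₂ _+_ (sumTo-cyclicSuc m h) (sumTo-cyclicPred m h)) ⟩
  (W + W) + 2 * W                         ≡⟨ cong (_+ 2 * W) (m+m≡2*m W) ⟩
  2 * W + 2 * W                           ≡⟨ m+m≡2*m (2 * W) ⟩
  2 * (2 * W)                             ∎))
  where
  open ≤-Reasoning
  n = suc m
  N = cycleNbrSum m h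
  W = sumTo n h

-- Optimal functions

alternating : ℕ → ℕ
alternating zero          = 1
alternating (suc zero)    = 0
alternating (suc (suc k)) = alternating k

alternating≤1 : ∀ k → alternating k ≤ 1
alternating≤1 zero          = ≤-refl
alternating≤1 (suc zero)    = z≤n
alternating≤1 (suc (suc k)) = alternating≤1 k

alternating-suc≡0 : ∀ k → alternating (suc k) ≡ 0 → alternating k ≡ 1
alternating-suc≡0 zero          _  = refl
alternating-suc≡0 (suc (suc k)) eq = alternating-suc≡0 k eq

sumTo-alternating : ∀ n → sumTo n alternating ≡ ⌈ n /2⌉
sumTo-alternating zero          = refl
sumTo-alternating (suc zero)    = refl
sumTo-alternating (suc (suc n)) = cong suc (sumTo-alternating n)

pathPattern : ℕ → ℕ → ℕ
pathPattern m i with i ≟ m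
... | yes _ = 1
... | no  _ = alternating i

pathPattern≤1 : ∀ m i → pathPattern m i ≤ 1
pathPattern≤1 m i with i ≟ m
... | yes _ = ≤-refl
... | no  _ = alternating≤1 i

pathPattern-last : ∀ m → pathPattern m m ≡ 1
pathPattern-last m with m ≟ m
... | yes _   = refl
... | no  m≢m = contradiction refl m≢m

pathPattern-< : ∀ {m i} → i < m → pathPattern m i ≡ alternating i
pathPattern-< {m} {i} i<m with i ≟ m
... | yes i≡m = contradiction i≡m (<⇒≢ i<m)
... | no  _   = refl

pathPattern-alternating : ∀ m i → alternating i ≡ 1 → pathPattern m i ≡ 1
pathPattern-alternating m i eq with i ≟ m
... | yes _ = refl
... | no  _ = eq

pathPattern≡0 : ∀ m i → pathPattern m i ≡ 0 → i ≢ m × alternating i ≡ 0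
pathPattern≡0 m i eq with i ≟ m
... | no  i≢m = i≢m , eq

sumTo-pathPattern : ∀ m → sumTo (suc m) (pathPattern m) ≡ ⌈ suc (suc m) /2⌉
sumTo-pathPattern m = begin
  sumTo (suc m) (pathPattern m)           ≡⟨ sumTo-snoc m (pathPattern m) ⟩
  sumTo m (pathPattern m) + pathPattern m m
    ≡⟨ cong₂ _+_ (sumTo-cong m (λ _ → pathPattern-<)) (pathPattern-last m) ⟩
  sumTo m alternating + 1                 ≡⟨ cong (_+ 1) (sumTo-alternating m) ⟩
  ⌈ m /2⌉ + 1                             ≡⟨ +-comm _ 1 ⟩
  ⌈ suc (suc m) /2⌉                       ∎
  where open ≡-Reasoning

pathPattern-perfect : ∀ m → let h = extend {suc m} (pathPattern m ∘ toℕ) in Perfect (suc m) (pathNbrSum h) h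
pathPattern-perfect m i i<n hi≡0 with pathPattern≡0 m i (trans (sym (extend-restrict (pathPattern m) i i<n)) hi≡0)
pathPattern-perfect m (suc j) 1+j<n _ | 1+j≢m , alt[1+j]≡0 = cong₂ _+_
  (trans (h≡pattern (2 + j) (s≤s 1+j<m)) (pathPattern-alternating m (2 + j) altj≡1))
  (trans (h≡pattern j (<⇒≤ 1+j<n)) (pathPattern-alternating m j altj≡1))
  where
  h≡pattern = extend-restrict {suc m} (pathPattern m)
  altj≡1 = alternating-suc≡0 j alt[1+j]≡0
  1+j<m = ≤∧≢⇒< (s≤s⁻¹ 1+j<n) 1+j≢m

alternating-perfectOnCycle : ∀ m → let h = extend {suc m} (alternating ∘ toℕ) in Perfect (suc m) (cycleNbrSum m h) h
alternating-perfectOnCycle m i i<n hi≡0 with trans (sym (extend-restrict alternating i i<n)) hi≡0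
alternating-perfectOnCycle m (suc j) 1+j<n _ | alt[1+j]≡0 = cong₂ _+_ successor predecessor
  where
  h = extend {suc m} (alternating ∘ toℕ)
  h≡alt = extend-restrict {suc m} alternating
  altj≡1 = alternating-suc≡0 j alt[1+j]≡0
  successor : h (cyclicSuc m (suc j)) ≡ 1
  successor with m≤n⇒m<n∨m≡n (s≤s⁻¹ 1+j<n)
  ... | inj₁ 1+j<m = trans (cong h (cyclicSuc-< 1+j<m)) (trans (h≡alt (2 + j) (s≤s 1+j<m)) altj≡1)
  ... | inj₂ refl  = trans (cong h (cyclicSuc-last m)) (h≡alt 0 z<s)
  predecessor : h j ≡ 1
  predecessor = trans (h≡alt j (<⇒≤ 1+j<n)) altj≡1

path-PIDNumber : ∀ n → 1 ≤ n → PIDNumberIs (path n) ⌈ suc n /2⌉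
path-PIDNumber (suc m) _ = PIDNumberIs-intro f
  (Perfect⇒IsPIDF (nbrSum-path f) (λ v → m≤n⇒m≤1+n (pathPattern≤1 m (toℕ v))) (pathPattern-perfect m))
  (trans (weight-restrict (suc m) (pathPattern m)) (sumTo-pathPattern m))
  (λ g g-PIDF → path-lowerBound m (extend g) (extend-≥ g (suc m) ≤-refl) (IsPIDF⇒Perfect (nbrSum-path g) g-PIDF))
  where
  f = pathPattern m ∘ toℕ

cycle-PIDNumber : ∀ n → 3 ≤ n → PIDNumberIs (cycle n) ⌈ n /2⌉
cycle-PIDNumber (suc m) 3≤n = PIDNumberIs-intro f
  (Perfect⇒IsPIDF (nbrSum-cycle 2≤m f) (λ v → m≤n⇒m≤1+n (alternating≤1 (toℕ v))) (alternating-perfectOnCycle m))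
  (trans (weight-restrict (suc m) alternating) (sumTo-alternating (suc m)))
  (λ g g-PIDF → cycle-lowerBound m (extend g) (IsPIDF⇒Perfect (nbrSum-cycle 2≤m g) g-PIDF))
  where
  2≤m = s≤s⁻¹ 3≤n
  f = alternating ∘ toℕ

proposition4 : (∀ (n : ℕ) → 1 ≤ n → PIDNumberIs (path n) ⌈ suc n /2⌉) × (∀ (n : ℕ) → 3 ≤ n → PIDNumberIs (cycle n) ⌈ n /2⌉)
proposition4 = path-PIDNumber , cycle-PIDNumber
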